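{- Let $A$ be a totally ordered alphabet and let $w=\ell_1\ell_2\cdots\ell_n$ where $\ell_1,\dots,\ell_n$ are Lyndon words with $\ell_1^\omega\ge\ell_2^\omega\ge\cdots\ge\ell_n^\omega$. Then $\ell_n$ is the shortest among all nonempty suffixes $s$ of $w$ for which $s^\omega$ is minimum (i.e. $s^\omega\le s'^\omega$ for every nonempty suffix $s'$ of $w$).
   Context: The order $<$ on finite and infinite words is the lexicographical order induced by the order of $A$. For a nonempty finite word $x$, $x^\omega=xxx\cdots$. A nonempty word $w$ is a Lyndon word if for every factorization $w=uv$ with $u,v$ nonempty one has $w<v$. -}

module Defs where

open import Level using (Level; _⊔_)
open import Data.Nat using (ℕ; _<_; _≤_; _%_)
open import Data.Nat.DivMod using (m%n<n)
open import Data.Fin using (fromℕ<)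
open import Data.List using (List; []; _∷_; _++_; length; lookup)
open import Data.List.NonEmpty using (List⁺; _∷_; toList)
open import Data.List.Relation.Binary.Lex.Strict using (Lex-<)
open import Data.Product using (Σ; ∃; _×_)
open import Data.Sum using (_⊎_)
open import Relation.Binary.PropositionalEquality using (_≡_; _≢_)

private variable a r : Level

module _ {A : Set a} (_≺_ : A → A → Set r) where

  -- lexicographic (strict) order on finite words; a proper prefix is smaller
  _<ₗ_ : List A → List A → Set (a ⊔ r)
  _<ₗ_ = Lex-< _≡_ _≺_

  Lyndon : List A → Set (a ⊔ r)
  Lyndon w = (w ≢ []) × (∀ u v → u ≢ [] → v ≢ [] → u ++ v ≡ w → w <ₗ v)

  _<ω_ : (ℕ → A) → (ℕ → A) → Set (a ⊔ r)
  x <ω y = ∃ λ k → (∀ i → i < k → x i ≡ y i) × (x k ≺ y k)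

  _≤ω_ : (ℕ → A) → (ℕ → A) → Set (a ⊔ r)
  x ≤ω y = (x <ω y) ⊎ (∀ i → x i ≡ y i)

_^ω : {A : Set a} → List⁺ A → ℕ → A
((c ∷ cs) ^ω) i = lookup (c ∷ cs) (fromℕ< (m%n<n i (length (c ∷ cs))))

Suffix : {A : Set a} → List A → List A → Set a
Suffix s w = ∃ λ u → u ++ s ≡ w

-- Three facts about ω-powers drive the proof: if u δ ≤ δ then u^ω ≤ δ; consequently
-- (x y)^ω ≥ min (x^ω, y^ω); and a proper suffix v of a Lyndon word ℓ satisfies
-- ℓ^ω < v^ω. A nonempty suffix of ℓ₁ ⋯ ℓₙ has the form v ℓᵢ₊₁ ⋯ ℓₙ with v a nonempty
-- suffix of ℓᵢ, so by induction on n its ω-power is at least min (ℓᵢ^ω) = ℓₙ^ω.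
-- A suffix s that is shorter than ℓₙ is a proper suffix of ℓₙ, hence s^ω > ℓₙ^ω.
module Submission where

open import Defs
open import Level using (Level; _⊔_)
open import Data.Nat using (ℕ; zero; suc; _+_; _≤_; _<_; z<s; s≤s⁻¹; _%_; s<s⁻¹; _<?_)
open import Data.Nat.Properties
  using (<-cmp; <-trans; <-irrefl; ≤-reflexive; ≤-trans; m≤m+n; m≤n+m; m<n+m; n<1+n; m<n⇒m<1+n;
         m<1+n⇒m<n∨m≡n;
         m≤n⇒∃[o]m+o≡n; ≮⇒≥; +-comm; module ≤-Reasoning)
open import Data.Nat.DivMod using (m<n⇒m%n≡m; [m+n]%n≡m%n)
open import Data.Nat.Induction using (<-rec)
open import Data.Fin using (fromℕ<)
open import Data.Fin.Properties using (fromℕ<-cong)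
open import Data.List using (List; []; _∷_; [_]; _++_; _∷ʳ_; concat; map; length; lookup)
open import Data.List.Properties
  using (∷-injective; length-++; length-++-comm; ++-identityʳ; map-++; concat-++)
open import Data.List.NonEmpty using (List⁺; toList) renaming (_∷_ to _∷⁺_)
open import Data.List.Relation.Unary.All using (All; []; _∷_; zip)
open import Data.List.Relation.Unary.All.Properties using (∷ʳ⁻)
open import Data.List.Relation.Unary.Linked using (Linked; _∷_)
open import Data.List.Relation.Binary.Lex.Core using (this; next)
open import Data.Product using (_×_; _,_; ∃; proj₂)
open import Data.Sum using (_⊎_; inj₁; inj₂)
open import Data.Empty using (⊥-elim)
open import Relation.Nullary using (¬_; yes; no; contradiction)
open import Relation.Binary.Core using (Rel)
open import Relation.Binary.Definitions using (Transitive; Reflexive; tri<; tri≈; tri>)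
open import Relation.Binary.PropositionalEquality
  using (_≡_; _≢_; refl; sym; trans; cong; subst; subst₂; module ≡-Reasoning)
open import Relation.Binary.Structures using (IsStrictTotalOrder)

suffix-of-++ : ∀ {b} {B : Set b} (u s x y : List B) → u ++ s ≡ x ++ y →
               Suffix s y ⊎ ∃ λ v → 0 < length v × s ≡ v ++ y × Suffix v x
suffix-of-++ []      s []      y eq = inj₁ ([] , eq)
suffix-of-++ []      s (c ∷ x) y eq = inj₂ (c ∷ x , z<s , eq , [] , refl)
suffix-of-++ (c ∷ u) s []      y eq = inj₁ (c ∷ u , eq)
suffix-of-++ (c ∷ u) s (d ∷ x) y eq with ∷-injective eq
... | refl , eq′ with suffix-of-++ u s x y eq′
...   | inj₁ s-suffix-y = inj₁ s-suffix-y
...   | inj₂ (v , v>0 , s≡v++y , u′ , u′++v≡x) = inj₂ (v , v>0 , s≡v++y , c ∷ u′ , cong (c ∷_) u′++v≡x)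

concat-map-∷ʳ : ∀ {b c} {B : Set b} {C : Set c} (f : B → List C) xs x →
                concat (map f (xs ∷ʳ x)) ≡ concat (map f xs) ++ f x
concat-map-∷ʳ f xs x = begin
  concat (map f (xs ++ [ x ]))      ≡⟨ cong concat (map-++ f xs [ x ]) ⟩
  concat (map f xs ++ [ f x ])      ≡⟨ concat-++ (map f xs) [ f x ] ⟨
  concat (map f xs) ++ (f x ++ [])  ≡⟨ cong (concat (map f xs) ++_) (++-identityʳ (f x)) ⟩
  concat (map f xs) ++ f x          ∎
  where open ≡-Reasoning

Linked-∷ʳ⇒All : ∀ {b ℓ} {B : Set b} {R : Rel B ℓ} → Transitive R → Reflexive R →
                ∀ xs {x} → Linked R (xs ∷ʳ x) → All (λ y → R y x) (xs ∷ʳ x)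
Linked-∷ʳ⇒All R-trans R-refl []           _          = R-refl ∷ []
Linked-∷ʳ⇒All R-trans R-refl (y ∷ [])     (Ryx ∷ _)  = Ryx ∷ R-refl ∷ []
Linked-∷ʳ⇒All R-trans R-refl (y ∷ z ∷ zs) (Ryz ∷ zs-linked)
  with Linked-∷ʳ⇒All R-trans R-refl (z ∷ zs) zs-linked
... | Rzx ∷ Rzsx = R-trans Ryz Rzx ∷ Rzx ∷ Rzsx

module OmegaOrder {a r} {A : Set a} (_≺_ : A → A → Set r) (sto : IsStrictTotalOrder _≡_ _≺_) where
  open IsStrictTotalOrder sto using (compare; irrefl) renaming (trans to ≺-trans)

  InfiniteWord : Set a
  InfiniteWord = ℕ → A

  _≈ω_ : InfiniteWord → InfiniteWord → Set a
  α ≈ω β = ∀ i → α i ≡ β i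

  _<ω⟨_⟩_ : InfiniteWord → ℕ → InfiniteWord → Set (a ⊔ r)
  α <ω⟨ j ⟩ β = (∀ i → i < j → α i ≡ β i) × (α j ≺ β j)

  ≈ω-refl : ∀ {α} → α ≈ω α
  ≈ω-refl i = refl

  ≈ω-sym : ∀ {α β} → α ≈ω β → β ≈ω α
  ≈ω-sym α≈β i = sym (α≈β i)

  ≈ω-trans : ∀ {α β γ} → α ≈ω β → β ≈ω γ → α ≈ω γ
  ≈ω-trans α≈β β≈γ i = trans (α≈β i) (β≈γ i)

  <ω-resp-≈ω : ∀ {α α′ β β′} → α ≈ω α′ → β ≈ω β′ → _<ω_ _≺_ α β → _<ω_ _≺_ α′ β′
  <ω-resp-≈ω α≈α′ β≈β′ (k , α≡β , αk≺βk) =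
    k , (λ i i<k → trans (sym (α≈α′ i)) (trans (α≡β i i<k) (β≈β′ i))) , subst₂ _≺_ (α≈α′ k) (β≈β′ k) αk≺βk

  ≤ω-resp-≈ω : ∀ {α α′ β β′} → α ≈ω α′ → β ≈ω β′ → _≤ω_ _≺_ α β → _≤ω_ _≺_ α′ β′
  ≤ω-resp-≈ω α≈α′ β≈β′ (inj₁ α<β) = inj₁ (<ω-resp-≈ω α≈α′ β≈β′ α<β)
  ≤ω-resp-≈ω α≈α′ β≈β′ (inj₂ α≈β) = inj₂ (≈ω-trans (≈ω-sym α≈α′) (≈ω-trans α≈β β≈β′))

  <ω-asym : ∀ {α β} → _<ω_ _≺_ α β → ¬ _<ω_ _≺_ β α
  <ω-asym (k , α≡β , αk≺βk) (k′ , β≡α , βk′≺αk′) with <-cmp k k′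
  ... | tri< k<k′ _ _ = irrefl (sym (β≡α k k<k′)) αk≺βk
  ... | tri≈ _ refl _ = irrefl refl (≺-trans αk≺βk βk′≺αk′)
  ... | tri> _ _ k′<k = irrefl (sym (α≡β k′ k′<k)) βk′≺αk′

  <ω⇒≱ω : ∀ {α β} → _<ω_ _≺_ α β → ¬ _≤ω_ _≺_ β α
  <ω⇒≱ω α<β (inj₁ β<α) = <ω-asym α<β β<α
  <ω⇒≱ω (k , _ , αk≺βk) (inj₂ β≈α) = irrefl (sym (β≈α k)) αk≺βk

  <ω-trans : ∀ {α β γ} → _<ω_ _≺_ α β → _<ω_ _≺_ β γ → _<ω_ _≺_ α γ
  <ω-trans {α} {β} {γ} (k , α≡β , αk≺βk) (k′ , β≡γ , βk′≺γk′) with <-cmp k k′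
  ... | tri< k<k′ _ _ =
    k , (λ i i<k → trans (α≡β i i<k) (β≡γ i (<-trans i<k k<k′))) ,
    subst (α k ≺_) (β≡γ k k<k′) αk≺βk
  ... | tri≈ _ refl _ = k , (λ i i<k → trans (α≡β i i<k) (β≡γ i i<k)) , ≺-trans αk≺βk βk′≺γk′
  ... | tri> _ _ k′<k =
    k′ , (λ i i<k′ → trans (α≡β i (<-trans i<k′ k′<k)) (β≡γ i i<k′)) ,
    subst (_≺ γ k′) (sym (α≡β k′ k′<k)) βk′≺γk′

  ≤ω-refl : ∀ {α} → _≤ω_ _≺_ α α
  ≤ω-refl = inj₂ ≈ω-refl

  ≤ω-trans : ∀ {α β γ} → _≤ω_ _≺_ α β → _≤ω_ _≺_ β γ → _≤ω_ _≺_ α γ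
  ≤ω-trans (inj₁ α<β) (inj₁ β<γ) = inj₁ (<ω-trans α<β β<γ)
  ≤ω-trans (inj₁ α<β) (inj₂ β≈γ) = inj₁ (<ω-resp-≈ω ≈ω-refl β≈γ α<β)
  ≤ω-trans (inj₂ α≈β) β≤γ        = ≤ω-resp-≈ω (≈ω-sym α≈β) ≈ω-refl β≤γ

  data CompareBelow (n : ℕ) (α β : InfiniteWord) : Set (a ⊔ r) where
    agree   : (∀ i → i < n → α i ≡ β i) → CompareBelow n α β
    less    : ∀ {j} → j < n → α <ω⟨ j ⟩ β → CompareBelow n α β
    greater : ∀ {j} → j < n → β <ω⟨ j ⟩ α → CompareBelow n α β

  compareBelow : ∀ n α β → CompareBelow n α β
  compareBelow zero    α β = agree (λ _ ())
  compareBelow (suc n) α β with compareBelow n α β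
  ... | less    j<n α<β = less    (m<n⇒m<1+n j<n) α<β
  ... | greater j<n β<α = greater (m<n⇒m<1+n j<n) β<α
  ... | agree α≡β with compare (α n) (β n)
  ...   | tri< αn≺βn _ _ = less    (n<1+n n) (α≡β , αn≺βn)
  ...   | tri> _ _ βn≺αn = greater (n<1+n n) ((λ i i<n → sym (α≡β i i<n)) , βn≺αn)
  ...   | tri≈ _ αn≡βn _ = agree α≡β-to-n
    where
    α≡β-to-n : ∀ i → i < suc n → α i ≡ β i
    α≡β-to-n i i<1+n with m<1+n⇒m<n∨m≡n i<1+n
    ... | inj₁ i<n  = α≡β i i<n
    ... | inj₂ refl = αn≡βn

  _◃_ : A → InfiniteWord → InfiniteWord
  (c ◃ α) zero    = c
  (c ◃ α) (suc i) = α i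

  ◃-mono-<ω : ∀ c {α β} → _<ω_ _≺_ α β → _<ω_ _≺_ (c ◃ α) (c ◃ β)
  ◃-mono-<ω c {α} {β} (k , α≡β , αk≺βk) = suc k , cα≡cβ , αk≺βk
    where
    cα≡cβ : ∀ i → i < suc k → (c ◃ α) i ≡ (c ◃ β) i
    cα≡cβ zero    _       = refl
    cα≡cβ (suc i) i<1+k = α≡β i (s<s⁻¹ i<1+k)

  _++ω_ : List A → InfiniteWord → InfiniteWord
  []      ++ω δ = δ
  (c ∷ u) ++ω δ = c ◃ (u ++ω δ)

  ++ω-agree : ∀ u {δ ε} j → (∀ i → i < j → δ i ≡ ε i) →
              ∀ i → i < length u + j → (u ++ω δ) i ≡ (u ++ω ε) i
  ++ω-agree []      j δ≡ε i       i<j   = δ≡ε i i<j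
  ++ω-agree (c ∷ u) j δ≡ε zero    _     = refl
  ++ω-agree (c ∷ u) j δ≡ε (suc i) i<u+j = ++ω-agree u j δ≡ε i (s<s⁻¹ i<u+j)

  ++ω-drop : ∀ u δ j → (u ++ω δ) (length u + j) ≡ δ j
  ++ω-drop []      δ j = refl
  ++ω-drop (c ∷ u) δ j = ++ω-drop u δ j

  ++ω-lookup : ∀ u δ i (i<u : i < length u) → (u ++ω δ) i ≡ lookup u (fromℕ< i<u)
  ++ω-lookup (c ∷ u) δ zero    _     = refl
  ++ω-lookup (c ∷ u) δ (suc i) i<1+u = ++ω-lookup u δ i (s<s⁻¹ i<1+u)

  ++ω-cong : ∀ u {δ ε} → δ ≈ω ε → (u ++ω δ) ≈ω (u ++ω ε)
  ++ω-cong []      δ≈ε i       = δ≈ε i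
  ++ω-cong (c ∷ u) δ≈ε zero    = refl
  ++ω-cong (c ∷ u) δ≈ε (suc i) = ++ω-cong u δ≈ε i

  ++ω-assoc : ∀ x y δ → ((x ++ y) ++ω δ) ≈ω (x ++ω (y ++ω δ))
  ++ω-assoc []      y δ i       = refl
  ++ω-assoc (c ∷ x) y δ zero    = refl
  ++ω-assoc (c ∷ x) y δ (suc i) = ++ω-assoc x y δ i

  ++ω-mono-<ω : ∀ u {δ ε} → _<ω_ _≺_ δ ε → _<ω_ _≺_ (u ++ω δ) (u ++ω ε)
  ++ω-mono-<ω []      δ<ε = δ<ε
  ++ω-mono-<ω (c ∷ u) δ<ε = ◃-mono-<ω c (++ω-mono-<ω u δ<ε)

  ++ω-mono-≤ω : ∀ u {δ ε} → _≤ω_ _≺_ δ ε → _≤ω_ _≺_ (u ++ω δ) (u ++ω ε)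
  ++ω-mono-≤ω u (inj₁ δ<ε) = inj₁ (++ω-mono-<ω u δ<ε)
  ++ω-mono-≤ω u (inj₂ δ≈ε) = inj₂ (++ω-cong u δ≈ε)

  ≈ω-periodic : ∀ p {α β} → 0 < p → (∀ j → α (p + j) ≡ α j) → (∀ j → β (p + j) ≡ β j) →
                (∀ i → i < p → α i ≡ β i) → α ≈ω β
  ≈ω-periodic p {α} {β} p>0 α-period β-period α≡β = <-rec (λ i → α i ≡ β i) agreeAt
    where
    agreeAt : ∀ i → (∀ {j} → j < i → α j ≡ β j) → α i ≡ β i
    agreeAt i agreeBelow with i <? p
    ... | yes i<p = α≡β i i<p
    ... | no  i≮p with m≤n⇒∃[o]m+o≡n (≮⇒≥ i≮p)
    ...   | j , refl = trans (α-period j) (trans (agreeBelow (m<n+m j p>0)) (sym (β-period j)))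

  -- α = u^ω, as the solution of α = u α, which is unique for nonempty u.
  OmegaPower : List A → InfiniteWord → Set a
  OmegaPower u α = α ≈ω (u ++ω α)

  OmegaPower-period : ∀ {u α} → OmegaPower u α → ∀ j → α (length u + j) ≡ α j
  OmegaPower-period {u} {α} α≈uα j = trans (α≈uα _) (++ω-drop u α j)

  OmegaPower-unique : ∀ {u α β} → 0 < length u → OmegaPower u α → OmegaPower u β → α ≈ω β
  OmegaPower-unique {u} {α} {β} u>0 α≈uα β≈uβ =
    ≈ω-periodic (length u) u>0 (OmegaPower-period {u} α≈uα) (OmegaPower-period {u} β≈uβ) α≡β
    where
    α≡β : ∀ i → i < length u → α i ≡ β i
    α≡β i i<u =
      trans (α≈uα i) (trans (++ω-agree u 0 (λ _ ()) i (≤-trans i<u (m≤m+n _ 0))) (sym (β≈uβ i)))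

  OmegaPower-++ω-agree : ∀ {u α δ} → 0 < length u → OmegaPower u α →
                         ∀ j → (∀ i → i < j → α i ≡ δ i) → (u ++ω δ) j ≡ α j
  OmegaPower-++ω-agree {u} u>0 α≈uα j α≡δ =
    trans (++ω-agree u j (λ i i<j → sym (α≡δ i i<j)) j (m<n+m j u>0)) (sym (α≈uα j))

  -- Compare α with δ up to the first position k where u δ < δ: a difference in favour
  -- of δ at j ≤ k would reappear in u δ, which agrees with α up to j.
  OmegaPower-≤ω : ∀ {u α δ} → 0 < length u → OmegaPower u α → _≤ω_ _≺_ (u ++ω δ) δ → _≤ω_ _≺_ α δ
  OmegaPower-≤ω {u} u>0 α≈uα (inj₂ uδ≈δ) = inj₂ (OmegaPower-unique {u} u>0 α≈uα (≈ω-sym uδ≈δ))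
  OmegaPower-≤ω {u} {α} {δ} u>0 α≈uα (inj₁ (k , uδ≡δ , uδk≺δk)) with compareBelow (suc k) α δ
  ... | less _ α<δ = inj₁ (_ , α<δ)
  ... | agree α≡δ = ⊥-elim (irrefl (trans uδk≡αk (α≡δ k (n<1+n k))) uδk≺δk)
    where
    uδk≡αk : (u ++ω δ) k ≡ α k
    uδk≡αk = OmegaPower-++ω-agree {u} u>0 α≈uα k (λ i i<k → α≡δ i (m<n⇒m<1+n i<k))
  ... | greater {j} j<1+k (δ≡α , δj≺αj)
    with m<1+n⇒m<n∨m≡n j<1+k | OmegaPower-++ω-agree {u} u>0 α≈uα j (λ i i<j → sym (δ≡α i i<j))
  ...   | inj₁ j<k  | uδj≡αj = ⊥-elim (irrefl (trans (sym (uδ≡δ j j<k)) uδj≡αj) δj≺αj)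
  ...   | inj₂ refl | uδj≡αj = ⊥-elim (irrefl uδj≡αj (≺-trans uδk≺δk δj≺αj))

  OmegaPower-rotate : ∀ x y {γ} → OmegaPower (x ++ y) γ → OmegaPower (y ++ x) (y ++ω γ)
  OmegaPower-rotate x y {γ} γ≈xyγ =
    ≈ω-trans (++ω-cong y (≈ω-trans γ≈xyγ (++ω-assoc x y γ))) (≈ω-sym (++ω-assoc y x (y ++ω γ)))

  -- Compare γ = (x y)^ω with y γ over one period: if they agree there, γ = y γ = y^ω;
  -- if y γ < γ then y^ω ≤ γ; if γ = x (y γ) < y γ then x^ω ≤ y γ, so x^ω = x x^ω ≤ x y γ = γ.
  OmegaPower-++-≥-min : ∀ x y {γ α β} → 0 < length x → 0 < length y →
                        OmegaPower (x ++ y) γ → OmegaPower x α → OmegaPower y β →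
                        _≤ω_ _≺_ α γ ⊎ _≤ω_ _≺_ β γ
  OmegaPower-++-≥-min x y {γ} {α} {β} x>0 y>0 γ≈xyγ α≈xα β≈yβ
    with compareBelow (length (x ++ y)) γ (y ++ω γ)
  ... | greater _ yγ<γ = inj₂ (OmegaPower-≤ω {y} y>0 β≈yβ (inj₁ (_ , yγ<γ)))
  ... | less _ γ<yγ =
    inj₁ (≤ω-resp-≈ω (≈ω-sym α≈xα) (≈ω-sym γ≈x[yγ])
           (++ω-mono-≤ω x (OmegaPower-≤ω {x} x>0 α≈xα (inj₁ (<ω-resp-≈ω γ≈x[yγ] ≈ω-refl (_ , γ<yγ))))))
    where
    γ≈x[yγ] : γ ≈ω (x ++ω (y ++ω γ))
    γ≈x[yγ] = ≈ω-trans γ≈xyγ (++ω-assoc x y γ)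
  ... | agree γ≡yγ = inj₂ (inj₂ (OmegaPower-unique {y} y>0 β≈yβ γ≈yγ))
    where
    xy>0 : 0 < length (x ++ y)
    xy>0 = subst (0 <_) (sym (length-++ x)) (≤-trans x>0 (m≤m+n _ _))
    yγ-period : ∀ j → (y ++ω γ) (length (x ++ y) + j) ≡ (y ++ω γ) j
    yγ-period j = trans (cong (λ p → (y ++ω γ) (p + j)) (length-++-comm x y))
                        (OmegaPower-period {y ++ x} (OmegaPower-rotate x y γ≈xyγ) j)
    γ≈yγ : γ ≈ω (y ++ω γ)
    γ≈yγ = ≈ω-periodic (length (x ++ y)) xy>0 (OmegaPower-period {x ++ y} γ≈xyγ) yγ-period γ≡yγ

  Lex-<⇒++ω-<ω : ∀ {u v} → _<ₗ_ _≺_ u v → length v ≤ length u → ∀ δ ε → _<ω_ _≺_ (u ++ω δ) (v ++ω ε)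
  Lex-<⇒++ω-<ω (this c≺d)                   _         δ ε = 0 , (λ _ ()) , c≺d
  Lex-<⇒++ω-<ω (next {x = c} refl u<v) v≤u δ ε = ◃-mono-<ω c (Lex-<⇒++ω-<ω u<v (s≤s⁻¹ v≤u) δ ε)

  Lyndon⇒<ω-proper-suffix : ∀ {ℓ} u v {α β} → Lyndon _≺_ ℓ → u ≢ [] → 0 < length v → u ++ v ≡ ℓ →
                            OmegaPower ℓ α → OmegaPower v β → _<ω_ _≺_ α β
  Lyndon⇒<ω-proper-suffix {ℓ} u v {α} {β} (_ , ℓ<suffix) u≢[] v>0 u++v≡ℓ α≈ℓα β≈vβ =
    <ω-resp-≈ω (≈ω-sym α≈ℓα) (≈ω-sym β≈vβ) (Lex-<⇒++ω-<ω (ℓ<suffix u v u≢[] v≢[] u++v≡ℓ) v≤ℓ α β)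
    where
    v≢[] : v ≢ []
    v≢[] v≡[] = <-irrefl refl (subst (λ z → 0 < length z) v≡[] v>0)
    v≤ℓ : length v ≤ length ℓ
    v≤ℓ = subst (length v ≤_) (trans (sym (length-++ u)) (cong length u++v≡ℓ)) (m≤n+m _ _)

  Lyndon⇒≤ω-suffix : ∀ {ℓ} v {α β} → Lyndon _≺_ ℓ → 0 < length v → Suffix v ℓ →
                     OmegaPower ℓ α → OmegaPower v β → _≤ω_ _≺_ α β
  Lyndon⇒≤ω-suffix v _  v>0 ([] , refl)    α≈vα β≈vβ = inj₂ (OmegaPower-unique {v} v>0 α≈vα β≈vβ)
  Lyndon⇒≤ω-suffix v ly v>0 (c ∷ u , u++v≡ℓ) α≈ℓα β≈vβ =
    inj₁ (Lyndon⇒<ω-proper-suffix (c ∷ u) v ly (λ ()) v>0 u++v≡ℓ α≈ℓα β≈vβ)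

  ^ω-OmegaPower : ∀ (x : List⁺ A) → OmegaPower (toList x) (x ^ω)
  ^ω-OmegaPower (c ∷⁺ cs) i with i <? length (c ∷ cs)
  ... | yes i<n = trans (cong (lookup (c ∷ cs)) (fromℕ<-cong _ _ (m<n⇒m%n≡m i<n) _ i<n))
                        (sym (++ω-lookup (c ∷ cs) ((c ∷⁺ cs) ^ω) i i<n))
  ... | no  i≮n with m≤n⇒∃[o]m+o≡n (≮⇒≥ i≮n)
  ...   | j , refl = trans (cong (lookup (c ∷ cs)) (fromℕ<-cong _ _ [n+j]%n≡j%n _ _))
                           (sym (++ω-drop (c ∷ cs) ((c ∷⁺ cs) ^ω) j))
    where
    [n+j]%n≡j%n : (length (c ∷ cs) + j) % length (c ∷ cs) ≡ j % length (c ∷ cs)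
    [n+j]%n≡j%n = trans (cong (_% length (c ∷ cs)) (+-comm (length (c ∷ cs)) j)) ([m+n]%n≡m%n j _)

  OmegaLowerBound : InfiniteWord → List A → Set (a ⊔ r)
  OmegaLowerBound m w = ∀ {s α} → 0 < length s → Suffix s w → OmegaPower s α → _≤ω_ _≺_ m α

  OmegaLowerBound-++ : ∀ {m} v R → 0 < length v → (∀ {β} → OmegaPower v β → _≤ω_ _≺_ m β) →
                       OmegaLowerBound m R → ∀ {α} → OmegaPower (v ++ R) α → _≤ω_ _≺_ m α
  OmegaLowerBound-++ v [] _ m≤v^ω _ α≈vα =
    m≤v^ω (subst (λ u → OmegaPower u _) (++-identityʳ v) α≈vα)
  OmegaLowerBound-++ (d ∷ v) (c ∷ R) _ m≤v^ω m≤R-suffixes α≈vRα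
    with OmegaPower-++-≥-min (d ∷ v) (c ∷ R) z<s z<s α≈vRα
           (^ω-OmegaPower (d ∷⁺ v)) (^ω-OmegaPower (c ∷⁺ R))
  ... | inj₁ v^ω≤α = ≤ω-trans (m≤v^ω (^ω-OmegaPower (d ∷⁺ v))) v^ω≤α
  ... | inj₂ R^ω≤α = ≤ω-trans (m≤R-suffixes z<s ([] , refl) (^ω-OmegaPower (c ∷⁺ R))) R^ω≤α

  OmegaLowerBound-Lyndon-++ : ∀ {m ℓ R γ} → Lyndon _≺_ ℓ → OmegaPower ℓ γ → _≤ω_ _≺_ m γ →
                              OmegaLowerBound m R → OmegaLowerBound m (ℓ ++ R)
  OmegaLowerBound-Lyndon-++ {ℓ = ℓ} {R} ly γ≈ℓγ m≤γ m≤R-suffixes {s} s>0 (u , u++s≡ℓ++R) α≈sα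
    with suffix-of-++ u s ℓ R u++s≡ℓ++R
  ... | inj₁ s-suffix-R = m≤R-suffixes s>0 s-suffix-R α≈sα
  ... | inj₂ (v , v>0 , refl , v-suffix-ℓ) =
    OmegaLowerBound-++ v R v>0 (λ β≈vβ → ≤ω-trans m≤γ (Lyndon⇒≤ω-suffix v ly v>0 v-suffix-ℓ γ≈ℓγ β≈vβ))
      m≤R-suffixes α≈sα

  OmegaLowerBound-concat : ∀ {m} ls → All (λ ℓ → Lyndon _≺_ (toList ℓ) × _≤ω_ _≺_ m (ℓ ^ω)) ls →
                           OmegaLowerBound m (concat (map toList ls))
  OmegaLowerBound-concat [] [] {_ ∷ _} _ ([] , ())
  OmegaLowerBound-concat [] [] {_ ∷ _} _ (_ ∷ _ , ())
  OmegaLowerBound-concat (ℓ ∷ ls) ((ly , m≤ℓ^ω) ∷ rest) =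
    OmegaLowerBound-Lyndon-++ ly (^ω-OmegaPower ℓ) m≤ℓ^ω (OmegaLowerBound-concat ls rest)

  Lyndon-suffix-shortest : ∀ (x : List A) (ℓ s : List⁺ A) → Lyndon _≺_ (toList ℓ) →
                           Suffix (toList s) (x ++ toList ℓ) → _≤ω_ _≺_ (s ^ω) (ℓ ^ω) →
                           length (toList ℓ) ≤ length (toList s)
  Lyndon-suffix-shortest x ℓ s@(_ ∷⁺ _) ly (u , u++s≡x++ℓ) s^ω≤ℓ^ω
    with suffix-of-++ u (toList s) x (toList ℓ) u++s≡x++ℓ
  ... | inj₁ ([] , s≡ℓ) = ≤-reflexive (cong length (sym s≡ℓ))
  ... | inj₁ (d ∷ u′ , u′++s≡ℓ) = contradiction s^ω≤ℓ^ω (<ω⇒≱ω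
    (Lyndon⇒<ω-proper-suffix (d ∷ u′) (toList s) ly (λ ()) z<s u′++s≡ℓ (^ω-OmegaPower ℓ) (^ω-OmegaPower s)))
  ... | inj₂ (v , _ , s≡v++ℓ , _) = begin
    length (toList ℓ)                  ≤⟨ m≤n+m _ (length v) ⟩
    length v + length (toList ℓ)       ≡⟨ length-++ v ⟨
    length (v ++ toList ℓ)             ≡⟨ cong length s≡v++ℓ ⟨
    length (toList s)                  ∎
    where open ≤-Reasoning

theorem5 : ∀ {a r : Level} {A : Set a} (_≺_ : A → A → Set r) → IsStrictTotalOrder _≡_ _≺_ →
           (ls : List (List⁺ A)) (ℓn : List⁺ A) →
           All (λ ℓ → Lyndon _≺_ (toList ℓ)) (ls ∷ʳ ℓn) →
           Linked (λ ℓ ℓ′ → _≤ω_ _≺_ (ℓ′ ^ω) (ℓ ^ω)) (ls ∷ʳ ℓn) →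
           let w = concat (map toList (ls ∷ʳ ℓn)) in
           Suffix (toList ℓn) w
           × (∀ (s′ : List⁺ A) → Suffix (toList s′) w → _≤ω_ _≺_ (ℓn ^ω) (s′ ^ω))
           × (∀ (s : List⁺ A) → Suffix (toList s) w →
                (∀ (s′ : List⁺ A) → Suffix (toList s′) w → _≤ω_ _≺_ (s ^ω) (s′ ^ω)) →
                length (toList ℓn) ≤ length (toList s))
theorem5 {A = A} _≺_ sto ls ℓn lyndon linked = ℓn-suffix , ℓn-minimal , ℓn-shortest
  where
  open OmegaOrder _≺_ sto

  w : List A
  w = concat (map toList (ls ∷ʳ ℓn))

  w≡prefix++ℓn : w ≡ concat (map toList ls) ++ toList ℓn
  w≡prefix++ℓn = concat-map-∷ʳ toList ls ℓn

  ℓn-suffix : Suffix (toList ℓn) w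
  ℓn-suffix = concat (map toList ls) , sym w≡prefix++ℓn

  ℓn^ω-least : All (λ ℓ → _≤ω_ _≺_ (ℓn ^ω) (ℓ ^ω)) (ls ∷ʳ ℓn)
  ℓn^ω-least = Linked-∷ʳ⇒All (λ ℓ′≤ℓ ℓ″≤ℓ′ → ≤ω-trans ℓ″≤ℓ′ ℓ′≤ℓ) ≤ω-refl ls linked

  ℓn-minimal : ∀ (s′ : List⁺ A) → Suffix (toList s′) w → _≤ω_ _≺_ (ℓn ^ω) (s′ ^ω)
  ℓn-minimal s′@(_ ∷⁺ _) s′-suffix =
    OmegaLowerBound-concat (ls ∷ʳ ℓn) (zip (lyndon , ℓn^ω-least)) z<s s′-suffix (^ω-OmegaPower s′)

  ℓn-shortest : ∀ (s : List⁺ A) → Suffix (toList s) w →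
                (∀ (s′ : List⁺ A) → Suffix (toList s′) w → _≤ω_ _≺_ (s ^ω) (s′ ^ω)) →
                length (toList ℓn) ≤ length (toList s)
  ℓn-shortest s s-suffix s-minimal =
    Lyndon-suffix-shortest (concat (map toList ls)) ℓn s (proj₂ (∷ʳ⁻ lyndon))
      (subst (Suffix (toList s)) w≡prefix++ℓn s-suffix) (s-minimal ℓn ℓn-suffix)
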